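{- Let $\Phi_1,\Phi_2,\Phi_1',\Phi_2'$ be core-wMSO formulas such that the set of weights occurring in $\Phi_1$ or $\Phi_2$ is disjoint from the set of weights occurring in $\Phi_1'$ or $\Phi_2'$. Then for every $(w,\sigma)$: $[\![\Phi_1]\!](w,\sigma)=[\![\Phi_2]\!](w,\sigma)$ and $[\![\Phi_1']\!](w,\sigma)=[\![\Phi_2']\!](w,\sigma)$ if and only if $[\![\Phi_1+\Phi_1']\!](w,\sigma)=[\![\Phi_2+\Phi_2']\!](w,\sigma)$.
   Context: Finite alphabet $\Sigma$, weight set $R$. MSO: $\varphi::=\top\mid P_a(x)\mid x\le y\mid x\in X\mid\neg\varphi\mid\varphi\wedge\varphi\mid\forall x.\varphi\mid\forall X.\varphi$, interpreted over $(w,\sigma)$ with $w\in\Sigma^+$ (nonempty) and $\sigma$ mapping first-order variables to positions and second-order variables to sets of positions. step-wMSO: $\Psi::=r\mid\varphi\,?\,\Psi_1:\Psi_2$ ($r\in R$), $[\![r]\!]=r$, conditional selects $\Psi_1$ if $\varphi$ holds, else $\Psi_2$. core-wMSO: $\Phi::=\mathbf{0}\mid\prod_x\Psi\mid\varphi\,?\,\Phi_1:\Phi_2\mid\Phi_1+\Phi_2\mid\sum_x\Phi\mid\sum_X\Phi$, with values finite multisets of words over $R$: $[\![\mathbf{0}]\!]=\emptyset$; $[\![\prod_x\Psi]\!](w,\sigma)$ the multiset with single word $r_1\cdots r_{|w|}$, $r_i=[\![\Psi]\!](w,\sigma[x\mapsto i])$; conditional selects by $\varphi$; $[\![\Phi_1+\Phi_2]\!]=[\![\Phi_1]\!]\uplus[\![\Phi_2]\!]$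 (multiset union); $[\![\sum_x\Phi]\!](w,\sigma)=\biguplus_{i=1}^{|w|}[\![\Phi]\!](w,\sigma[x\mapsto i])$; $[\![\sum_X\Phi]\!](w,\sigma)=\biguplus_{I\subseteq\{1,\dots,|w|\}}[\![\Phi]\!](w,\sigma[X\mapsto I])$. The weights occurring in a formula are the elements of $R$ appearing in it syntactically. -}

module Defs where

open import Data.Nat using (ℕ; zero; suc; _≟_; _≤ᵇ_)
open import Data.Fin using (Fin; toℕ)
open import Data.Fin.Subset using (Subset)
open import Data.Bool using (Bool; true; false; not; _∧_; if_then_else_)
open import Data.Vec using (Vec; []; _∷_; lookup)
open import Data.List using (List; []; _∷_; [_]; _++_; map; concatMap; allFin)
open import Data.Product using (_×_; _,_; proj₁; proj₂)
open import Relation.Nullary.Decidable using (⌊_⌋)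
import Data.Fin as F

Var : Set
Var = ℕ

data MSO (k : ℕ) : Set where
  ⊤'   : MSO k
  P    : Fin k → Var → MSO k
  _≤'_ : Var → Var → MSO k
  _∈'_ : Var → Var → MSO k
  ¬'_  : MSO k → MSO k
  _∧'_ : MSO k → MSO k → MSO k
  ∀₁   : Var → MSO k → MSO k
  ∀₂   : Var → MSO k → MSO k

data Step (k : ℕ) (R : Set) : Set where
  wt   : R → Step k R
  _⁇_∶_ : MSO k → Step k R → Step k R → Step k R

data Core (k : ℕ) (R : Set) : Set where
  𝟘     : Core k R
  Π₁    : Var → Step k R → Core k R
  cond  : MSO k → Core k R → Core k R → Core k R
  _⊕_   : Core k R → Core k R → Core k R
  Σ₁    : Var → Core k R → Core k R
  Σ₂    : Var → Core k R → Core k R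

Word : ℕ → ℕ → Set
Word k m = Vec (Fin k) (suc m)

Assignment : ℕ → Set
Assignment m = (Var → Fin (suc m)) × (Var → Subset (suc m))

upd₁ : ∀ {m} → Assignment m → Var → Fin (suc m) → Assignment m
upd₁ (f , g) x i = (λ y → if ⌊ y ≟ x ⌋ then i else f y) , g

upd₂ : ∀ {m} → Assignment m → Var → Subset (suc m) → Assignment m
upd₂ (f , g) X I = f , (λ Y → if ⌊ Y ≟ X ⌋ then I else g Y)

allL : ∀ {A : Set} → (A → Bool) → List A → Bool
allL p [] = true
allL p (x ∷ xs) = p x ∧ allL p xs

allSubsets : (n : ℕ) → List (Subset n)
allSubsets zero = [ [] ]
allSubsets (suc n) = map (true ∷_) (allSubsets n) ++ map (false ∷_) (allSubsets n)

⟦_⟧ : ∀ {k m} → MSO k → Word k m → Assignment m → Bool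
⟦ ⊤' ⟧ w σ = true
⟦ P a x ⟧ w σ = ⌊ lookup w (proj₁ σ x) F.≟ a ⌋
⟦ x ≤' y ⟧ w σ = toℕ (proj₁ σ x) ≤ᵇ toℕ (proj₁ σ y)
⟦ x ∈' X ⟧ w σ = lookup (proj₂ σ X) (proj₁ σ x)
⟦ ¬' φ ⟧ w σ = not (⟦ φ ⟧ w σ)
⟦ φ ∧' ψ ⟧ w σ = ⟦ φ ⟧ w σ ∧ ⟦ ψ ⟧ w σ
⟦ ∀₁ x φ ⟧ w σ = allL (λ i → ⟦ φ ⟧ w (upd₁ σ x i)) (allFin _)
⟦ ∀₂ X φ ⟧ w σ = allL (λ I → ⟦ φ ⟧ w (upd₂ σ X I)) (allSubsets _)

⟦_⟧ˢ : ∀ {k R m} → Step k R → Word k m → Assignment m → R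
⟦ wt r ⟧ˢ w σ = r
⟦ φ ⁇ Ψ₁ ∶ Ψ₂ ⟧ˢ w σ = if ⟦ φ ⟧ w σ then ⟦ Ψ₁ ⟧ˢ w σ else ⟦ Ψ₂ ⟧ˢ w σ

-- Finite multisets of words over R are represented by lists of words,
-- compared up to permutation (_↭_).
⟦_⟧ᶜ : ∀ {k R m} → Core k R → Word k m → Assignment m → List (List R)
⟦ 𝟘 ⟧ᶜ w σ = []
⟦ Π₁ x Ψ ⟧ᶜ w σ = [ map (λ i → ⟦ Ψ ⟧ˢ w (upd₁ σ x i)) (allFin _) ]
⟦ cond φ Φ₁ Φ₂ ⟧ᶜ w σ = if ⟦ φ ⟧ w σ then ⟦ Φ₁ ⟧ᶜ w σ else ⟦ Φ₂ ⟧ᶜ w σ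
⟦ Φ₁ ⊕ Φ₂ ⟧ᶜ w σ = ⟦ Φ₁ ⟧ᶜ w σ ++ ⟦ Φ₂ ⟧ᶜ w σ
⟦ Σ₁ x Φ ⟧ᶜ w σ = concatMap (λ i → ⟦ Φ ⟧ᶜ w (upd₁ σ x i)) (allFin _)
⟦ Σ₂ X Φ ⟧ᶜ w σ = concatMap (λ I → ⟦ Φ ⟧ᶜ w (upd₂ σ X I)) (allSubsets _)

weightsˢ : ∀ {k R} → Step k R → List R
weightsˢ (wt r) = [ r ]
weightsˢ (φ ⁇ Ψ₁ ∶ Ψ₂) = weightsˢ Ψ₁ ++ weightsˢ Ψ₂

weights : ∀ {k R} → Core k R → List R
weights 𝟘 = []
weights (Π₁ x Ψ) = weightsˢ Ψ
weights (cond φ Φ₁ Φ₂) = weights Φ₁ ++ weights Φ₂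
weights (Φ₁ ⊕ Φ₂) = weights Φ₁ ++ weights Φ₂
weights (Σ₁ x Φ) = weights Φ
weights (Σ₂ X Φ) = weights Φ

-- Every word in the semantics of a core-wMSO formula Φ is a nonempty word
-- over the weights occurring in Φ. When the weights of the two sides are
-- disjoint, no word of ⟦Φ₁⟧ or ⟦Φ₂⟧ can occur in ⟦Φ₁′⟧ or ⟦Φ₂′⟧, so a
-- multiset equality ⟦Φ₁⟧ ⊎ ⟦Φ₁′⟧ = ⟦Φ₂⟧ ⊎ ⟦Φ₂′⟧ splits into its two parts.
module Submission where

open import Defs
open import Data.Nat using (ℕ)
open import Data.List using (List; []; _∷_; [_]; _++_; allFin)
open import Data.List.Properties using (++-assoc)
open import Data.List.Membership.Propositional using (_∈_)
open import Data.List.Membership.Propositional.Properties using (∈-++⁻; ∈-++⁺ˡ; ∈-++⁺ʳ; ∈-∃++)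
open import Data.List.Relation.Binary.Subset.Propositional using (_⊆_)
open import Data.List.Relation.Binary.Disjoint.Propositional using (Disjoint)
open import Data.List.Relation.Binary.Permutation.Propositional
  using (_↭_; ↭-refl; ↭-sym; ↭-trans; ↭-reflexive; prep)
open import Data.List.Relation.Binary.Permutation.Propositional.Properties
  using (∈-resp-↭; drop-mid; shift; ++⁺)
open import Data.List.Relation.Unary.All as All using (All; []; _∷_)
import Data.List.Relation.Unary.All.Properties as All
open import Data.List.Relation.Unary.Any using (here)
open import Data.Product using (_×_; _,_)
open import Data.Sum using (inj₁; inj₂)
open import Data.Bool using (true; false)
open import Data.Empty using (⊥; ⊥-elim)
open import Relation.Nullary using (¬_)
open import Relation.Binary.PropositionalEquality using (refl; sym; _≢_)
open import Function.Bundles using (_⇔_; mk⇔)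

module _ {A : Set} where

  NonemptyWordOver : List A → List A → Set
  NonemptyWordOver S u = u ≢ [] × All (_∈ S) u

  nonemptyWordOver-mono : ∀ {S T u} → S ⊆ T → NonemptyWordOver S u → NonemptyWordOver T u
  nonemptyWordOver-mono S⊆T (u≢[] , u⊆S) = u≢[] , All.map S⊆T u⊆S

  nonemptyWordOver-disjoint : ∀ {S T u} → Disjoint S T →
    NonemptyWordOver S u → ¬ NonemptyWordOver T u
  nonemptyWordOver-disjoint {u = []}    _   (u≢[] , _)      _               = u≢[] refl
  nonemptyWordOver-disjoint {u = _ ∷ _} S#T (_ , r∈S ∷ _) (_ , r∈T ∷ _) = S#T (r∈S , r∈T)

module _ {A : Set} {P Q : A → Set} (P#Q : ∀ {x} → P x → ¬ Q x) where

  ++-↭-cancel : ∀ xs xs′ ys ys′ → All P xs → All P ys → All Q xs′ → All Q ys′ →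
    xs ++ xs′ ↭ ys ++ ys′ → xs ↭ ys × xs′ ↭ ys′
  ++-↭-cancel [] xs′ [] ys′ _ _ _ _ p = ↭-refl , p
  ++-↭-cancel [] xs′ (y ∷ _) ys′ _ (Py ∷ _) Qxs′ _ p =
    ⊥-elim (P#Q Py (All.lookup Qxs′ (∈-resp-↭ (↭-sym p) (here refl))))
  ++-↭-cancel (x ∷ xs) xs′ ys ys′ (Px ∷ Pxs) Pys Qxs′ Qys′ p
    with ∈-++⁻ ys (∈-resp-↭ p (here refl))
  ... | inj₂ x∈ys′ = ⊥-elim (P#Q Px (All.lookup Qys′ x∈ys′))
  ... | inj₁ x∈ys with ∈-∃++ x∈ys
  ... | ys₁ , ys₂ , refl =
    let xs↭ys₁ys₂ , xs′↭ys′ = ++-↭-cancel xs xs′ (ys₁ ++ ys₂) ys′ Pxs Pys₁ys₂ Qxs′ Qys′ tails↭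
    in ↭-trans (prep x xs↭ys₁ys₂) (↭-sym (shift x ys₁ ys₂)) , xs′↭ys′
    where
    Pys₁ys₂ : All P (ys₁ ++ ys₂)
    Pys₁ys₂ with Pys₁ , _ ∷ Pys₂ ← All.++⁻ ys₁ Pys = All.++⁺ Pys₁ Pys₂

    -- x is removed from both sides; drop-mid needs the right side reassociated
    tails↭ : xs ++ xs′ ↭ (ys₁ ++ ys₂) ++ ys′
    tails↭ = ↭-trans (drop-mid [] ys₁ (↭-trans p (↭-reflexive (++-assoc ys₁ (x ∷ ys₂) ys′))))
                     (↭-reflexive (sym (++-assoc ys₁ ys₂ ys′)))

module _ {k : ℕ} {R : Set} where

  ⟦⟧ˢ∈weightsˢ : ∀ {m} (Ψ : Step k R) (w : Word k m) σ → ⟦ Ψ ⟧ˢ w σ ∈ weightsˢ Ψ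
  ⟦⟧ˢ∈weightsˢ (wt r) w σ = here refl
  ⟦⟧ˢ∈weightsˢ (φ ⁇ Ψ₁ ∶ Ψ₂) w σ with ⟦ φ ⟧ w σ
  ... | true  = ∈-++⁺ˡ (⟦⟧ˢ∈weightsˢ Ψ₁ w σ)
  ... | false = ∈-++⁺ʳ (weightsˢ Ψ₁) (⟦⟧ˢ∈weightsˢ Ψ₂ w σ)

  ⟦⟧ᶜ-over-weights : ∀ {m} (Φ : Core k R) (w : Word k m) σ →
    All (NonemptyWordOver (weights Φ)) (⟦ Φ ⟧ᶜ w σ)
  ⟦⟧ᶜ-over-weights 𝟘 w σ = []
  ⟦⟧ᶜ-over-weights (Π₁ x Ψ) w σ =
    ((λ ()) , All.map⁺ (All.universal (λ i → ⟦⟧ˢ∈weightsˢ Ψ w (upd₁ σ x i)) (allFin _))) ∷ []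
  ⟦⟧ᶜ-over-weights (cond φ Φ₁ Φ₂) w σ with ⟦ φ ⟧ w σ
  ... | true  = All.map (nonemptyWordOver-mono ∈-++⁺ˡ) (⟦⟧ᶜ-over-weights Φ₁ w σ)
  ... | false = All.map (nonemptyWordOver-mono (∈-++⁺ʳ (weights Φ₁)))
                        (⟦⟧ᶜ-over-weights Φ₂ w σ)
  ⟦⟧ᶜ-over-weights (Φ₁ ⊕ Φ₂) w σ = All.++⁺
    (All.map (nonemptyWordOver-mono ∈-++⁺ˡ) (⟦⟧ᶜ-over-weights Φ₁ w σ))
    (All.map (nonemptyWordOver-mono (∈-++⁺ʳ (weights Φ₁))) (⟦⟧ᶜ-over-weights Φ₂ w σ))
  ⟦⟧ᶜ-over-weights (Σ₁ x Φ) w σ = All.concat⁺ (All.map⁺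
    (All.universal (λ i → ⟦⟧ᶜ-over-weights Φ w (upd₁ σ x i)) (allFin _)))
  ⟦⟧ᶜ-over-weights (Σ₂ X Φ) w σ = All.concat⁺ (All.map⁺
    (All.universal (λ I → ⟦⟧ᶜ-over-weights Φ w (upd₂ σ X I)) (allSubsets _)))

lemma14 : {k : ℕ} {R : Set} (Φ₁ Φ₂ Φ₁′ Φ₂′ : Core k R) →
    (∀ (r : R) → r ∈ (weights Φ₁ ++ weights Φ₂) → r ∈ (weights Φ₁′ ++ weights Φ₂′) → ⊥) →
    ∀ {m : ℕ} (w : Word k m) (σ : Assignment m) →
    ((⟦ Φ₁ ⟧ᶜ w σ ↭ ⟦ Φ₂ ⟧ᶜ w σ) × (⟦ Φ₁′ ⟧ᶜ w σ ↭ ⟦ Φ₂′ ⟧ᶜ w σ))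
    ⇔ (⟦ Φ₁ ⊕ Φ₁′ ⟧ᶜ w σ ↭ ⟦ Φ₂ ⊕ Φ₂′ ⟧ᶜ w σ)
lemma14 Φ₁ Φ₂ Φ₁′ Φ₂′ disjoint w σ = mk⇔ (λ (p , p′) → ++⁺ p p′)
  (++-↭-cancel (nonemptyWordOver-disjoint (λ (r∈S , r∈S′) → disjoint _ r∈S r∈S′)) _ _ _ _
    (wordsOverˡ Φ₁ Φ₂) (wordsOverʳ Φ₁ Φ₂) (wordsOverˡ Φ₁′ Φ₂′) (wordsOverʳ Φ₁′ Φ₂′))
  where
  wordsOverˡ : ∀ Φ Φ′ → All (NonemptyWordOver (weights Φ ++ weights Φ′)) (⟦ Φ ⟧ᶜ w σ)
  wordsOverˡ Φ Φ′ = All.map (nonemptyWordOver-mono ∈-++⁺ˡ) (⟦⟧ᶜ-over-weights Φ w σ)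

  wordsOverʳ : ∀ Φ Φ′ → All (NonemptyWordOver (weights Φ ++ weights Φ′)) (⟦ Φ′ ⟧ᶜ w σ)
  wordsOverʳ Φ Φ′ = All.map (nonemptyWordOver-mono (∈-++⁺ʳ (weights Φ))) (⟦⟧ᶜ-over-weights Φ′ w σ)
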